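{- If $\mathcal{L}$ is an abstract intuitionistic logic invariant under asimulations, then for every pointed $\Theta$-model $(\mathcal{M},w)$, every $v\in W$ with $wRv$, and every $\phi\in L(\Theta)$: if $\mathcal{M},w\models_\mathcal{L}\phi$ then $\mathcal{M},v\models_\mathcal{L}\phi$.
   Context: A $\Theta$-model $\mathcal{M}=\langle W,R,V\rangle$: $W$ nonempty, $R$ a preorder, $V:\Theta\to2^W$ upward closed along $R$. An abstract intuitionistic logic $\mathcal{L}=(L,\models_\mathcal{L})$ assigns to each vocabulary $\Theta$ a set $L(\Theta)$ of formulas with a satisfaction relation on pointed $\Theta$-models (monotone in $\Theta$, isomorphism invariant, invariant under reducts/expansions, finite occurrence vocabularies, closed under $\to,\wedge,\vee$). An asimulation from $(\mathcal{M}_1,w_1)$ to $(\mathcal{M}_2,w_2)$ is $A\subseteq(W_1\times W_2)\cup(W_2\times W_1)$ with $w_1Aw_2$ such that for all $\{i,j\}=\{1,2\}$, $v\in W_i$, $s,t\in W_j$, $p$: $vAs$, $v\in V_i(p)$ imply $s\in V_j(p)$; $vAs$, $sR_jt$ imply some $u\in W_i$ with $vR_iu$, $tAu$, $uAt$. $\mathcal{L}$ is invariant under asimulations if whenever there is an asimulation from $(\mathcal{M}_1,w_1)$ to $(\mathcal{M}_2,w_2)$, every formula of $\mathcal{L}$ true at $(\mathcal{M}_1,w_1)$ is true at $(\mathcal{M}_2,w_2)$. -}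

module Defs where

open import Level using (0ℓ)
open import Data.Product using (Σ; _×_; _,_)
open import Data.Sum using (_⊎_)
open import Data.List using (List)
open import Data.List.Membership.Propositional using (_∈_)
open import Relation.Unary using (Pred; _⊆_)
open import Relation.Binary.PropositionalEquality using (_≡_)

Vocab : Set → Set₁
Vocab Sym = Pred Sym 0ℓ

record Model (Sym : Set) (Θ : Vocab Sym) : Set₁ where
  field
    W        : Set
    nonempty : W
    R        : W → W → Set
    R-refl   : ∀ w → R w w
    R-trans  : ∀ {u v w} → R u v → R v w → R u w
    V        : (p : Sym) → Θ p → W → Set
    V-up     : ∀ p (θ : Θ p) {u v} → R u v → V p θ u → V p θ v
open Model public

reduct : ∀ {Sym} {Θ Θ' : Vocab Sym} → Θ ⊆ Θ' → Model Sym Θ' → Model Sym Θ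
reduct h M = record
  { W = W M ; nonempty = nonempty M ; R = R M ; R-refl = R-refl M
  ; R-trans = R-trans M ; V = λ p θ → V M p (h θ) ; V-up = λ p θ → V-up M p (h θ) }

record Iso {Sym} {Θ : Vocab Sym} (M₁ M₂ : Model Sym Θ) : Set where
  field
    to      : W M₁ → W M₂
    from    : W M₂ → W M₁
    from-to : ∀ x → from (to x) ≡ x
    to-from : ∀ y → to (from y) ≡ y
    R-to    : ∀ {x y} → R M₁ x y → R M₂ (to x) (to y)
    R-from  : ∀ {x y} → R M₂ (to x) (to y) → R M₁ x y
    V-to    : ∀ p (θ : Θ p) x → V M₁ p θ x → V M₂ p θ (to x)
    V-from  : ∀ p (θ : Θ p) x → V M₂ p θ (to x) → V M₁ p θ x

Finite : ∀ {Sym} → Vocab Sym → Set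
Finite {Sym} Θ = Σ (List Sym) λ xs → ∀ {x} → Θ x → x ∈ xs

_⇔_ : Set → Set → Set
A ⇔ B = (A → B) × (B → A)

record AbstractIntuitionisticLogic (Sym : Set) : Set₁ where
  field
    L   : Vocab Sym → Set
    sat : ∀ {Θ} (M : Model Sym Θ) → W M → L Θ → Set
    emb : ∀ {Θ Θ'} → Θ ⊆ Θ' → L Θ → L Θ'
    iso-inv : ∀ {Θ} {M₁ M₂ : Model Sym Θ} (i : Iso M₁ M₂) (w : W M₁) (φ : L Θ) →
              sat M₁ w φ ⇔ sat M₂ (Iso.to i w) φ
    reduct-inv : ∀ {Θ Θ'} (h : Θ ⊆ Θ') (M : Model Sym Θ') (w : W M) (φ : L Θ) →
                 sat M w (emb h φ) ⇔ sat (reduct h M) w φ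
    finite-occ : ∀ {Θ} (φ : L Θ) →
                 Σ (Vocab Sym) λ Θ₀ → Σ (Θ₀ ⊆ Θ) λ h → Finite Θ₀ × Σ (L Θ₀) λ φ₀ → emb h φ₀ ≡ φ
    imp : ∀ {Θ} (φ ψ : L Θ) → Σ (L Θ) λ χ → ∀ (M : Model Sym Θ) w →
          sat M w χ ⇔ (∀ v → R M w v → sat M v φ → sat M v ψ)
    conj : ∀ {Θ} (φ ψ : L Θ) → Σ (L Θ) λ χ → ∀ (M : Model Sym Θ) w →
           sat M w χ ⇔ (sat M w φ × sat M w ψ)
    disj : ∀ {Θ} (φ ψ : L Θ) → Σ (L Θ) λ χ → ∀ (M : Model Sym Θ) w →
           sat M w χ ⇔ (sat M w φ ⊎ sat M w ψ)
open AbstractIntuitionisticLogic public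

-- One direction of the asimulation conditions (i = source, j = target),
-- with A split into A_ij ⊆ W_i × W_j and A_ji ⊆ W_j × W_i.
AsimHalf : ∀ {Sym} {Θ : Vocab Sym} (Mi Mj : Model Sym Θ) →
           (W Mi → W Mj → Set) → (W Mj → W Mi → Set) → Set
AsimHalf Mi Mj Aij Aji =
  (∀ {v s} p (θ : _) → Aij v s → V Mi p θ v → V Mj p θ s) ×
  (∀ {v s t} → Aij v s → R Mj s t →
     Σ (W Mi) λ u → R Mi v u × Aji t u × Aij u t)

record Asimulation {Sym} {Θ : Vocab Sym} (M₁ : Model Sym Θ) (w₁ : W M₁)
                   (M₂ : Model Sym Θ) (w₂ : W M₂) : Set₁ where
  field
    A₁₂   : W M₁ → W M₂ → Set
    A₂₁   : W M₂ → W M₁ → Set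
    start : A₁₂ w₁ w₂
    half₁ : AsimHalf M₁ M₂ A₁₂ A₂₁
    half₂ : AsimHalf M₂ M₁ A₂₁ A₁₂

InvariantUnderAsimulations : ∀ {Sym} → AbstractIntuitionisticLogic Sym → Set₁
InvariantUnderAsimulations {Sym} 𝓛 =
  ∀ {Θ} (M₁ : Model Sym Θ) (w₁ : W M₁) (M₂ : Model Sym Θ) (w₂ : W M₂) →
  Asimulation M₁ w₁ M₂ w₂ → (φ : L 𝓛 Θ) → sat 𝓛 M₁ w₁ φ → sat 𝓛 M₂ w₂ φ

module Submission where

open import Defs
open import Data.Product using (_,_)

-- The accessibility relation R itself is an asimulation from (M, w) to (M, v)
-- whenever w R v: atoms are preserved by upward closure of V, and an R-step
-- s R t out of v R s is answered by t, reached from v by transitivity.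

R-asimHalf : ∀ {Sym} {Θ : Vocab Sym} (M : Model Sym Θ) → AsimHalf M M (R M) (R M)
R-asimHalf M =
  (λ p θ → V-up M p θ) ,
  (λ {_} {_} {t} vRs sRt → t , R-trans M vRs sRt , R-refl M t , R-refl M t)

R-asimulation : ∀ {Sym} {Θ : Vocab Sym} (M : Model Sym Θ) {w v : W M} →
                R M w v → Asimulation M w M v
R-asimulation M wRv = record
  { A₁₂ = R M ; A₂₁ = R M ; start = wRv
  ; half₁ = R-asimHalf M ; half₂ = R-asimHalf M }

lemma4p4 : ∀ {Sym : Set} (𝓛 : AbstractIntuitionisticLogic Sym) →
    InvariantUnderAsimulations 𝓛 →
    ∀ {Θ : Vocab Sym} (M : Model Sym Θ) (w v : W M) → R M w v →
    (φ : L 𝓛 Θ) → sat 𝓛 M w φ → sat 𝓛 M v φ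
lemma4p4 𝓛 invariant M w v wRv = invariant M w M v (R-asimulation M wRv)
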